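{- Let $q$ be an odd prime power and let $\lambda,\mu$ be positive integers with $\mu\le\lambda$. (a) If $q\equiv3\pmod4$ and $\lambda$ is odd, then both $\frac{(q^{\mu}+1)(q^{\lambda-\mu}+1)}{2(q^{\lambda}+1)}{\lambda\brack\mu}_{q^2}$ and $\frac{(q^{\mu}-1)(q^{\lambda-\mu}-1)}{2(q^{\lambda}+1)}{\lambda\brack\mu}_{q^2}$ are integers. (b) If either $q\equiv3\pmod4$ and $\lambda$ is even, or $q\equiv1\pmod4$, then both $\frac{(q^{\mu}+1)(q^{\lambda-\mu}-1)}{2(q^{\lambda}-1)}{\lambda\brack\mu}_{q^2}$ and $\frac{(q^{\mu}-1)(q^{\lambda-\mu}+1)}{2(q^{\lambda}-1)}{\lambda\brack\mu}_{q^2}$ are integers.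
   Context: Gaussian binomial coefficient: ${a\brack b}_Q=\prod_{i=0}^{b-1}\frac{Q^a-Q^i}{Q^b-Q^i}$ for integers $1\le b\le a$. -}

module Defs where

open import Data.Nat as ℕ using (ℕ; zero; suc; _%_)
open import Data.Nat.Primality using (Prime)
open import Data.Integer using (ℤ; +_)
open import Data.Rational using (ℚ; 0ℚ; 1ℚ; _/_; _+_; _-_; _*_; _÷_; ≢-nonZero)
open import Data.Rational.Properties using (_≟_)
open import Data.List using (List; map; foldr; upTo)
open import Data.Product using (Σ; _×_; ∃)
open import Relation.Nullary using (yes; no)
open import Relation.Binary.PropositionalEquality using (_≡_)

IsPrimePower : ℕ → Set
IsPrimePower q = Σ ℕ λ p → Σ ℕ λ k → Prime p × q ≡ p ℕ.^ suc k

IsOdd : ℕ → Set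
IsOdd n = n % 2 ≡ 1

ℕ→ℚ : ℕ → ℚ
ℕ→ℚ n = (+ n) / 1

ℤ→ℚ : ℤ → ℚ
ℤ→ℚ z = z / 1

IsInteger : ℚ → Set
IsInteger r = ∃ λ (z : ℤ) → r ≡ ℤ→ℚ z

-- total division on ℚ (value 0 on division by 0); only ever applied to
-- nonzero divisors in the statement
_÷'_ : ℚ → ℚ → ℚ
p ÷' r with r ≟ 0ℚ
... | yes _ = 0ℚ
... | no r≢0 = _÷_ p r {{≢-nonZero r≢0}}

prodℚ : List ℚ → ℚ
prodℚ = foldr _*_ 1ℚ

gaussBinom : (Q a b : ℕ) → ℚ
gaussBinom Q a b =
  prodℚ (map (λ i → (ℕ→ℚ (Q ℕ.^ a) - ℕ→ℚ (Q ℕ.^ i)) ÷' (ℕ→ℚ (Q ℕ.^ b) - ℕ→ℚ (Q ℕ.^ i))) (upTo b))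

-- Write a = q^μ, b = q^(λ−μ) and G = [λ μ]_{q²}, and let s = ±1. The number
-- W = (b + s a) G / (ab + s) is an integer: combining the two Pascal rules of G,
-- it equals s b [λ−1 μ−1]_{q²} + a [λ−1 μ]_{q²}, because
-- (b + s a)(ab − s) = a (b² − 1) + s b (a² − 1). For ε, δ = ±1 and s = εδ one has
-- (a + ε)(b + δ) = (ab + s) + ε (b + s a), so each of the four quotients of the
-- statement is (G + ε W)/2, and G ≡ W (mod 2) because q is odd.
module Submission where

module Integral where

  open import Data.Nat.Base as ℕ using (ℕ; zero; suc; _<_; s≤s)
  open import Data.Integer.Base using (ℤ; +_; 0ℤ; 1ℤ; -1ℤ; _+_; _-_; _*_; -_; _^_)
  open import Data.Integer.Properties
    using (pos-*; *-identityˡ; *-identityʳ; +-identityʳ; *-distribʳ-+; +-comm; *-commutativeSemigroup)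
  open import Data.Integer.Divisibility.Signed
    using (_∣_; divides; ∣-refl; ∣m∣n⇒∣m+n; ∣m⇒∣-m; ∣m⇒∣m*n; ∣n⇒∣m*n; *-monoˡ-∣)
  open import Data.Integer.Tactic.RingSolver using (solve-∀)
  open import Algebra.Properties.CommutativeSemigroup *-commutativeSemigroup using (interchange)
  open import Relation.Binary.PropositionalEquality
    using (_≡_; _≢_; refl; sym; trans; cong; cong₂; subst; module ≡-Reasoning)
  open ≡-Reasoning

  pos-^ : ∀ m n → + (m ℕ.^ n) ≡ (+ m) ^ n
  pos-^ m zero    = refl
  pos-^ m (suc n) = trans (pos-* m (m ℕ.^ n)) (cong ((+ m) *_) (pos-^ m n))

  ^-distrib-* : ∀ i j n → (i * j) ^ n ≡ i ^ n * j ^ n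
  ^-distrib-* i j zero    = refl
  ^-distrib-* i j (suc n) = trans (cong ((i * j) *_) (^-distrib-* i j n)) (interchange i j (i ^ n) (j ^ n))

  -- gauss Q m n is the Gaussian binomial [m+n m]_Q.
  gauss : ℤ → ℕ → ℕ → ℤ
  gauss Q zero    n       = 1ℤ
  gauss Q (suc m) zero    = 1ℤ
  gauss Q (suc m) (suc n) = gauss Q m (suc n) + Q ^ suc m * gauss Q (suc m) n

  pascal-difference : ∀ a b {c A B} → c ≡ A + a * B → c ≡ b * A + B → (b - 1ℤ) * A ≡ (a - 1ℤ) * B
  pascal-difference a b {c} {A} {B} c≡₁ c≡₂ = begin
    (b - 1ℤ) * A            ≡⟨ expand b A B ⟩
    (b * A + B) - (A + B)   ≡⟨ cong (_- (A + B)) (trans (sym c≡₂) c≡₁) ⟩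
    (A + a * B) - (A + B)   ≡⟨ collect a A B ⟩
    (a - 1ℤ) * B            ∎
    where
    expand : ∀ b A B → (b - 1ℤ) * A ≡ (b * A + B) - (A + B)
    expand = solve-∀
    collect : ∀ a A B → (A + a * B) - (A + B) ≡ (a - 1ℤ) * B
    collect = solve-∀

  module _ (Q : ℤ) where

    gauss-n-zero : ∀ m → gauss Q m zero ≡ 1ℤ
    gauss-n-zero zero    = refl
    gauss-n-zero (suc m) = refl

    gauss-pascalʳ : ∀ m n → gauss Q (suc m) (suc n) ≡ Q ^ suc n * gauss Q m (suc n) + gauss Q (suc m) n
    gauss-pascalʳ zero zero = +-comm 1ℤ (Q ^ 1 * 1ℤ)
    gauss-pascalʳ zero (suc n) = begin
      1ℤ + Q ^ 1 * gauss Q 1 (suc n)                 ≡⟨ cong (λ g → 1ℤ + Q ^ 1 * g) (gauss-pascalʳ zero n) ⟩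
      1ℤ + Q ^ 1 * (Q ^ suc n * 1ℤ + gauss Q 1 n)    ≡⟨ step Q (Q ^ suc n) (gauss Q 1 n) ⟩
      Q ^ suc (suc n) * 1ℤ + gauss Q 1 (suc n)      ∎
      where
      step : ∀ Q P G → 1ℤ + Q * 1ℤ * (P * 1ℤ + G) ≡ Q * P * 1ℤ + (1ℤ + Q * 1ℤ * G)
      step = solve-∀
    gauss-pascalʳ (suc m) zero = begin
      gauss Q (suc m) 1 + Q ^ suc (suc m) * 1ℤ            ≡⟨ cong (_+ Q ^ suc (suc m) * 1ℤ) (gauss-pascalʳ m zero) ⟩
      Q ^ 1 * gauss Q m 1 + 1ℤ + Q ^ suc (suc m) * 1ℤ     ≡⟨ step Q (Q ^ suc m) (gauss Q m 1) ⟩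
      Q ^ 1 * gauss Q (suc m) 1 + 1ℤ                      ∎
      where
      step : ∀ Q P G → Q * 1ℤ * G + 1ℤ + Q * P * 1ℤ ≡ Q * 1ℤ * (G + P * 1ℤ) + 1ℤ
      step = solve-∀
    gauss-pascalʳ (suc m) (suc n) = begin
      gauss Q (suc m) (suc (suc n)) + Q ^ suc (suc m) * gauss Q (suc (suc m)) (suc n)
        ≡⟨ cong₂ (λ g h → g + Q ^ suc (suc m) * h) (gauss-pascalʳ m (suc n)) (gauss-pascalʳ (suc m) n) ⟩
      Q ^ suc (suc n) * gauss Q m (suc (suc n)) + gauss Q (suc m) (suc n)
        + Q ^ suc (suc m) * (Q ^ suc n * gauss Q (suc m) (suc n) + gauss Q (suc (suc m)) n)
        ≡⟨ step Q (Q ^ suc m) (Q ^ suc n) (gauss Q m (suc (suc n))) (gauss Q (suc m) (suc n)) (gauss Q (suc (suc m)) n) ⟩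
      Q ^ suc (suc n) * (gauss Q m (suc (suc n)) + Q ^ suc m * gauss Q (suc m) (suc n))
        + (gauss Q (suc m) (suc n) + Q ^ suc (suc m) * gauss Q (suc (suc m)) n)
        ∎
      where
      step : ∀ Q P R A B C → Q * R * A + B + Q * P * (R * B + C) ≡ Q * R * (A + P * B) + (B + Q * P * C)
      step = solve-∀

    gauss-absorption : ∀ m n → (Q ^ suc m * Q ^ n - 1ℤ) * gauss Q m n ≡ (Q ^ suc m - 1ℤ) * gauss Q (suc m) n
    gauss-absorption m zero =
      cong₂ (λ P g → (P - 1ℤ) * g) (*-identityʳ (Q ^ suc m)) (gauss-n-zero m)
    gauss-absorption m (suc n) = begin
      (P * R - 1ℤ) * A                        ≡⟨ split P R A ⟩
      (P - 1ℤ) * A + P * ((R - 1ℤ) * A)       ≡⟨ cong (λ t → (P - 1ℤ) * A + P * t) (pascal-difference P R refl (gauss-pascalʳ m n)) ⟩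
      (P - 1ℤ) * A + P * ((P - 1ℤ) * B)       ≡⟨ merge P A B ⟩
      (P - 1ℤ) * (A + P * B)                  ∎
      where
      P R A B : ℤ
      P = Q ^ suc m
      R = Q ^ suc n
      A = gauss Q m (suc n)
      B = gauss Q (suc m) n
      split : ∀ P R A → (P * R - 1ℤ) * A ≡ (P - 1ℤ) * A + P * ((R - 1ℤ) * A)
      split = solve-∀
      merge : ∀ P A B → (P - 1ℤ) * A + P * ((P - 1ℤ) * B) ≡ (P - 1ℤ) * (A + P * B)
      merge = solve-∀

  data IsUnit : ℤ → Set where
    unit⁺ : IsUnit 1ℤ
    unit⁻ : IsUnit -1ℤ

  IsUnit-square : ∀ {u} → IsUnit u → u * u ≡ 1ℤ
  IsUnit-square unit⁺ = refl
  IsUnit-square unit⁻ = refl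

  IsUnit-odd : ∀ {u} → IsUnit u → + 2 ∣ u - 1ℤ
  IsUnit-odd unit⁺ = divides 0ℤ refl
  IsUnit-odd unit⁻ = divides -1ℤ refl

  IsUnit-* : ∀ {u v} → IsUnit u → IsUnit v → IsUnit (u * v)
  IsUnit-* unit⁺ unit⁺ = unit⁺
  IsUnit-* unit⁺ unit⁻ = unit⁻
  IsUnit-* unit⁻ unit⁺ = unit⁻
  IsUnit-* unit⁻ unit⁻ = unit⁺

  pos+unit≢0 : ∀ {n u} → 1 < n → IsUnit u → + n + u ≢ 0ℤ
  pos+unit≢0 (s≤s (s≤s _)) unit⁺ ()
  pos+unit≢0 (s≤s (s≤s _)) unit⁻ ()

  ∣m-1∣n-1⇒∣m*n-1 : ∀ {k} m n → k ∣ m - 1ℤ → k ∣ n - 1ℤ → k ∣ m * n - 1ℤ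
  ∣m-1∣n-1⇒∣m*n-1 {k} m n k∣m-1 k∣n-1 =
    subst (k ∣_) (sym (split m n)) (∣m∣n⇒∣m+n (∣n⇒∣m*n m k∣n-1) k∣m-1)
    where
    split : ∀ m n → m * n - 1ℤ ≡ m * (n - 1ℤ) + (m - 1ℤ)
    split = solve-∀

  ∣m-1⇒∣m^n-1 : ∀ {k} m n → k ∣ m - 1ℤ → k ∣ m ^ n - 1ℤ
  ∣m-1⇒∣m^n-1 m zero    k∣m-1 = divides 0ℤ refl
  ∣m-1⇒∣m^n-1 m (suc n) k∣m-1 = ∣m-1∣n-1⇒∣m*n-1 m (m ^ n) k∣m-1 (∣m-1⇒∣m^n-1 m n k∣m-1)

  twist-identity : ∀ a b s {G G₁ G₂} → s * s ≡ 1ℤ → G ≡ G₁ + a * a * G₂ → G ≡ b * b * G₁ + G₂ →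
                   (a * b + s) * (s * b * G₁ + a * G₂) ≡ (b + s * a) * G
  twist-identity a b s {G} {G₁} {G₂} s²≡1 G≡₁ G≡₂ = begin
    (a * b + s) * (s * b * G₁ + a * G₂)                ≡⟨ expand a b s G₁ G₂ ⟩
    b * (s * s * G₁ + a * a * G₂) + s * a * (b * b * G₁ + G₂)
      ≡⟨ cong (λ t → b * (t * G₁ + a * a * G₂) + s * a * (b * b * G₁ + G₂)) s²≡1 ⟩
    b * (1ℤ * G₁ + a * a * G₂) + s * a * (b * b * G₁ + G₂)
      ≡⟨ cong₂ (λ g h → b * (g + a * a * G₂) + s * a * h) (*-identityˡ G₁) (sym G≡₂) ⟩
    b * (G₁ + a * a * G₂) + s * a * G                  ≡⟨ cong (λ g → b * g + s * a * G) (sym G≡₁) ⟩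
    b * G + s * a * G                                  ≡⟨ *-distribʳ-+ G b (s * a) ⟨
    (b + s * a) * G                                    ∎
    where
    expand : ∀ a b s G₁ G₂ → (a * b + s) * (s * b * G₁ + a * G₂) ≡ b * (s * s * G₁ + a * a * G₂) + s * a * (b * b * G₁ + G₂)
    expand = solve-∀

  module _ (x : ℤ) where

    gauss-pascalˡ² : ∀ m n → gauss (x * x) (suc m) (suc n) ≡ gauss (x * x) m (suc n) + x ^ suc m * x ^ suc m * gauss (x * x) (suc m) n
    gauss-pascalˡ² m n = cong (λ P → gauss (x * x) m (suc n) + P * gauss (x * x) (suc m) n) (^-distrib-* x x (suc m))

    gauss-pascalʳ² : ∀ m n → gauss (x * x) (suc m) (suc n) ≡ x ^ suc n * x ^ suc n * gauss (x * x) m (suc n) + gauss (x * x) (suc m) n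
    gauss-pascalʳ² m n = trans (gauss-pascalʳ (x * x) m n)
      (cong (λ P → P * gauss (x * x) m (suc n) + gauss (x * x) (suc m) n) (^-distrib-* x x (suc n)))

    -- The integer W of the proof idea, with μ = m + 1 and λ − μ = n.
    twist : ℤ → ℕ → ℕ → ℤ
    twist s m zero    = s
    twist s m (suc n) = s * x ^ suc n * gauss (x * x) m (suc n) + x ^ suc m * gauss (x * x) (suc m) n

    twist-spec : ∀ {s} → s * s ≡ 1ℤ → ∀ m n →
                 (x ^ suc m * x ^ n + s) * twist s m n ≡ (x ^ n + s * x ^ suc m) * gauss (x * x) (suc m) n
    twist-spec {s} s²≡1 m zero = begin
      (x ^ suc m * 1ℤ + s) * s       ≡⟨ expand (x ^ suc m) s ⟩
      (s * s + s * x ^ suc m) * 1ℤ   ≡⟨ cong (λ t → (t + s * x ^ suc m) * 1ℤ) s²≡1 ⟩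
      (1ℤ + s * x ^ suc m) * 1ℤ      ∎
      where
      expand : ∀ a s → (a * 1ℤ + s) * s ≡ (s * s + s * a) * 1ℤ
      expand = solve-∀
    twist-spec s²≡1 m (suc n) = twist-identity (x ^ suc m) (x ^ suc n) _ s²≡1 (gauss-pascalˡ² m n) (gauss-pascalʳ² m n)

    gauss-twist-even : + 2 ∣ x - 1ℤ → ∀ {s} → IsUnit s → ∀ m n → + 2 ∣ gauss (x * x) (suc m) n - twist s m n
    gauss-twist-even x-odd unit⁺ m zero = divides 0ℤ refl
    gauss-twist-even x-odd unit⁻ m zero = divides 1ℤ refl
    gauss-twist-even x-odd {s} s-unit m (suc n) =
      subst (+ 2 ∣_) (sym difference)
        (∣m∣n⇒∣m+n (∣m⇒∣m*n G₁ (∣m⇒∣-m s*b-odd)) (∣m⇒∣m*n G₂ (∣n⇒∣m*n a (∣m-1⇒∣m^n-1 x (suc m) x-odd))))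
      where
      a b G₁ G₂ : ℤ
      a = x ^ suc m
      b = x ^ suc n
      G₁ = gauss (x * x) m (suc n)
      G₂ = gauss (x * x) (suc m) n
      s*b-odd : + 2 ∣ s * b - 1ℤ
      s*b-odd = ∣m-1∣n-1⇒∣m*n-1 s b (IsUnit-odd s-unit) (∣m-1⇒∣m^n-1 x (suc n) x-odd)
      rearrange : ∀ a b s G₁ G₂ → (G₁ + a * a * G₂) - (s * b * G₁ + a * G₂) ≡ (- (s * b - 1ℤ)) * G₁ + a * (a - 1ℤ) * G₂
      rearrange = solve-∀
      difference : gauss (x * x) (suc m) (suc n) - twist s m (suc n) ≡ (- (s * b - 1ℤ)) * G₁ + a * (a - 1ℤ) * G₂
      difference = trans (cong (_- twist s m (suc n)) (gauss-pascalˡ² m n)) (rearrange a b s G₁ G₂)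

    quotient-divisible : + 2 ∣ x - 1ℤ → ∀ {ε δ} → IsUnit ε → IsUnit δ → ∀ m n →
      + 2 * (x ^ suc m * x ^ n + ε * δ) ∣ (x ^ suc m + ε) * (x ^ n + δ) * gauss (x * x) (suc m) n
    quotient-divisible x-odd {ε} {δ} ε-unit δ-unit m n =
      subst (+ 2 * c ∣_) numerator (*-monoˡ-∣ c 2∣G+εW)
      where
      a b c G W : ℤ
      a = x ^ suc m
      b = x ^ n
      c = a * b + ε * δ
      G = gauss (x * x) (suc m) n
      W = twist (ε * δ) m n
      regroup : ∀ G W ε → (G - W) + ((ε - 1ℤ) * W + + 2 * W) ≡ G + ε * W
      regroup = solve-∀
      2∣G+εW : + 2 ∣ G + ε * W
      2∣G+εW = subst (+ 2 ∣_) (regroup G W ε)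
        (∣m∣n⇒∣m+n (gauss-twist-even x-odd (IsUnit-* ε-unit δ-unit) m n)
                   (∣m∣n⇒∣m+n (∣m⇒∣m*n W (IsUnit-odd ε-unit)) (∣m⇒∣m*n W ∣-refl)))
      expand : ∀ a b ε δ G W → (G + ε * W) * (a * b + ε * δ) ≡ (a * b + ε * δ) * G + ε * ((a * b + ε * δ) * W)
      expand = solve-∀
      collect : ∀ a b ε δ G → (a * b + ε * δ) * G + ε * ((b + ε * δ * a) * G) ≡ (a + ε) * (b + δ) * G + (ε * ε - 1ℤ) * (δ * a * G)
      collect = solve-∀
      numerator : (G + ε * W) * c ≡ (a + ε) * (b + δ) * G
      numerator = begin
        (G + ε * W) * c                                      ≡⟨ expand a b ε δ G W ⟩
        c * G + ε * (c * W)
          ≡⟨ cong (λ t → c * G + ε * t) (twist-spec (IsUnit-square (IsUnit-* ε-unit δ-unit)) m n) ⟩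
        c * G + ε * ((b + ε * δ * a) * G)                    ≡⟨ collect a b ε δ G ⟩
        (a + ε) * (b + δ) * G + (ε * ε - 1ℤ) * (δ * a * G)
          ≡⟨ cong (λ t → (a + ε) * (b + δ) * G + (t - 1ℤ) * (δ * a * G)) (IsUnit-square ε-unit) ⟩
        (a + ε) * (b + δ) * G + 0ℤ                           ≡⟨ +-identityʳ _ ⟩
        (a + ε) * (b + δ) * G                                ∎

module Embedding where

  open import Defs
  open import Data.Integer.Base as ℤ using (ℤ; 0ℤ; 1ℤ)
  import Data.Integer.Properties as ℤ
  open import Data.Rational.Base using (0ℚ; 1ℚ; _+_; _*_; -_; 1/_; toℚᵘ; ≢-nonZero)
  open import Data.Rational.Properties
    using (_≟_; *-assoc; *-zeroˡ; *-zeroʳ; *-identityʳ; *-inverseʳ; *-1-commutativeMonoid; heytingCommutativeRing;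
           toℚᵘ-homo-+; toℚᵘ-homo-*; toℚᵘ-homo‿-; toℚᵘ-fromℚᵘ; fromℚᵘ-toℚᵘ; fromℚᵘ-cong; fromℚᵘ-injective)
  open import Data.Rational.Unnormalised.Base using (mkℚᵘ; *≡*) renaming (_≃_ to _≃ᵘ_)
  open import Data.Rational.Unnormalised.Properties as ℚᵘ using (≃-trans)
  open import Data.Integer.Tactic.RingSolver using (solve-∀)
  open import Algebra.Bundles using (CommutativeMonoid)
  open import Algebra.Properties.CommutativeSemigroup (CommutativeMonoid.commutativeSemigroup *-1-commutativeMonoid)
    using (x∙yz≈y∙xz; xy∙z≈y∙xz; xy∙z≈xz∙y)
  open import Algebra.Apartness.Properties.HeytingCommutativeRing heytingCommutativeRing using (x#0y#0→xy#0)
  open import Function.Base using (_∘_)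
  open import Relation.Nullary.Decidable.Core using (Dec; yes; no)
  open import Relation.Nullary.Negation.Core using (contradiction)
  open import Relation.Binary.PropositionalEquality
    using (_≡_; _≢_; refl; sym; trans; cong; module ≡-Reasoning)
  open ≡-Reasoning

  private
    ≡ℤ→ℚ : ∀ p i → toℚᵘ p ≃ᵘ mkℚᵘ i 0 → p ≡ ℤ→ℚ i
    ≡ℤ→ℚ p i p≃i = trans (sym (fromℚᵘ-toℚᵘ p)) (fromℚᵘ-cong p≃i)

  ℤ→ℚ-homo-+ : ∀ i j → ℤ→ℚ (i ℤ.+ j) ≡ ℤ→ℚ i + ℤ→ℚ j
  ℤ→ℚ-homo-+ i j = sym (≡ℤ→ℚ (ℤ→ℚ i + ℤ→ℚ j) (i ℤ.+ j)
    (≃-trans (toℚᵘ-homo-+ (ℤ→ℚ i) (ℤ→ℚ j))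
      (≃-trans (ℚᵘ.+-cong (toℚᵘ-fromℚᵘ (mkℚᵘ i 0)) (toℚᵘ-fromℚᵘ (mkℚᵘ j 0))) (*≡* (same-denominator i j)))))
    where
    same-denominator : ∀ i j → (i ℤ.* 1ℤ ℤ.+ j ℤ.* 1ℤ) ℤ.* 1ℤ ≡ (i ℤ.+ j) ℤ.* 1ℤ
    same-denominator = solve-∀

  ℤ→ℚ-homo-* : ∀ i j → ℤ→ℚ (i ℤ.* j) ≡ ℤ→ℚ i * ℤ→ℚ j
  ℤ→ℚ-homo-* i j = sym (≡ℤ→ℚ (ℤ→ℚ i * ℤ→ℚ j) (i ℤ.* j)
    (≃-trans (toℚᵘ-homo-* (ℤ→ℚ i) (ℤ→ℚ j)) (ℚᵘ.*-cong (toℚᵘ-fromℚᵘ (mkℚᵘ i 0)) (toℚᵘ-fromℚᵘ (mkℚᵘ j 0)))))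

  ℤ→ℚ-homo‿- : ∀ i → ℤ→ℚ (ℤ.- i) ≡ - ℤ→ℚ i
  ℤ→ℚ-homo‿- i = sym (≡ℤ→ℚ (- ℤ→ℚ i) (ℤ.- i)
    (≃-trans (toℚᵘ-homo‿- (ℤ→ℚ i)) (ℚᵘ.-‿cong (toℚᵘ-fromℚᵘ (mkℚᵘ i 0)))))

  ℤ→ℚ-injective : ∀ {i j} → ℤ→ℚ i ≡ ℤ→ℚ j → i ≡ j
  ℤ→ℚ-injective {i} {j} eq with fromℚᵘ-injective {mkℚᵘ i 0} {mkℚᵘ j 0} eq
  ... | *≡* i*1≡j*1 = trans (sym (ℤ.*-identityʳ i)) (trans i*1≡j*1 (ℤ.*-identityʳ j))

  ÷'-≢0 : ∀ p {y} (y≢0 : y ≢ 0ℚ) → p ÷' y ≡ p * (1/ y) {{≢-nonZero y≢0}}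
  ÷'-≢0 p {y} y≢0 with y ≟ 0ℚ
  ... | yes y≡0 = contradiction y≡0 y≢0
  ... | no _    = refl

  *-÷'-cancel : ∀ p {y} → y ≢ 0ℚ → y * (p ÷' y) ≡ p
  *-÷'-cancel p {y} y≢0 = begin
    y * (p ÷' y)     ≡⟨ cong (y *_) (÷'-≢0 p y≢0) ⟩
    y * (p * 1/ y)   ≡⟨ x∙yz≈y∙xz y p (1/ y) ⟩
    p * (y * 1/ y)   ≡⟨ cong (p *_) (*-inverseʳ y) ⟩
    p * 1ℚ           ≡⟨ *-identityʳ p ⟩
    p                ∎
    where instance _ = ≢-nonZero y≢0

  ÷'-unique : ∀ {p y z} → y ≢ 0ℚ → y * z ≡ p → p ÷' y ≡ z
  ÷'-unique {p} {y} {z} y≢0 y*z≡p = begin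
    p ÷' y           ≡⟨ ÷'-≢0 p y≢0 ⟩
    p * 1/ y         ≡⟨ cong (_* 1/ y) (sym y*z≡p) ⟩
    y * z * 1/ y     ≡⟨ xy∙z≈y∙xz y z (1/ y) ⟩
    z * (y * 1/ y)   ≡⟨ cong (z *_) (*-inverseʳ y) ⟩
    z * 1ℚ           ≡⟨ *-identityʳ z ⟩
    z                ∎
    where instance _ = ≢-nonZero y≢0

  ÷'-*-comm : ∀ p y r → (p ÷' y) * r ≡ (p * r) ÷' y
  ÷'-*-comm p y r with y ≟ 0ℚ
  ... | yes _  = *-zeroˡ r
  ... | no y≢0 = xy∙z≈xz∙y p (1/ y) r
    where instance _ = ≢-nonZero y≢0

  ÷'-scale : ∀ {c} → c ≢ 0ℚ → ∀ p y → (c * p) ÷' (c * y) ≡ p ÷' y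
  ÷'-scale {c} c≢0 p y = scale (y ≟ 0ℚ)
    where
    scale : Dec (y ≡ 0ℚ) → (c * p) ÷' (c * y) ≡ p ÷' y
    scale (yes y≡0) = trans (cong ((c * p) ÷'_) (trans (cong (c *_) y≡0) (*-zeroʳ c))) (cong (p ÷'_) (sym y≡0))
    scale (no y≢0)  = ÷'-unique (x#0y#0→xy#0 c≢0 y≢0) (begin
      c * y * (p ÷' y)     ≡⟨ *-assoc c y (p ÷' y) ⟩
      c * (y * (p ÷' y))   ≡⟨ cong (c *_) (*-÷'-cancel p y≢0) ⟩
      c * p                ∎)

  ℤ→ℚ-÷'-exact : ∀ X Y g Z → Y ≢ 0ℤ → X ℤ.* g ≡ Z ℤ.* Y → (ℤ→ℚ X ÷' ℤ→ℚ Y) * ℤ→ℚ g ≡ ℤ→ℚ Z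
  ℤ→ℚ-÷'-exact X Y g Z Y≢0 Xg≡ZY = begin
    (ℤ→ℚ X ÷' ℤ→ℚ Y) * ℤ→ℚ g    ≡⟨ ÷'-*-comm (ℤ→ℚ X) (ℤ→ℚ Y) (ℤ→ℚ g) ⟩
    (ℤ→ℚ X * ℤ→ℚ g) ÷' ℤ→ℚ Y    ≡⟨ cong (_÷' ℤ→ℚ Y) (sym (ℤ→ℚ-homo-* X g)) ⟩
    ℤ→ℚ (X ℤ.* g) ÷' ℤ→ℚ Y      ≡⟨ ÷'-unique (Y≢0 ∘ ℤ→ℚ-injective) Y*Z≡Xg ⟩
    ℤ→ℚ Z                        ∎
    where
    Y*Z≡Xg : ℤ→ℚ Y * ℤ→ℚ Z ≡ ℤ→ℚ (X ℤ.* g)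
    Y*Z≡Xg = trans (sym (ℤ→ℚ-homo-* Y Z)) (cong ℤ→ℚ (trans (ℤ.*-comm Y Z) (sym Xg≡ZY)))

open Integral
open Embedding

open import Defs
open import Data.Nat using (ℕ; _≤_; _∸_; _^_; _%_)
open import Data.Rational using (ℚ; _+_; _-_; _*_; 1ℚ)
open import Data.Product using (_×_)
open import Data.Sum using (_⊎_)
open import Relation.Binary.PropositionalEquality using (_≡_)
open import Data.Nat.Base as ℕ using (zero; suc; _<_; z<s; nonTrivial⇒n>1)
open import Data.Nat.Properties as ℕ using (^-monoʳ-<; m+[n∸m]≡n)
open import Data.Nat.DivMod using (m≡m%n+[m/n]*n)
open import Data.Nat.Primality using (prime⇒nonTrivial)
open import Data.Integer.Base as ℤ using (ℤ; +_; 0ℤ; 1ℤ)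
open import Data.Integer.Properties as ℤ using (pos-*; ^-distribˡ-+-*; i*j≡0⇒i≡0∨j≡0)
open import Data.Integer.Divisibility.Signed using (_∣_; divides)
open import Data.Integer.Tactic.RingSolver using (solve-∀)
open import Data.Rational.Base using (0ℚ)
open import Data.List.Base as List using (applyUpTo; upTo; map)
open import Data.List.Properties using (map-upTo)
open import Data.Product using (_,_)
open import Data.Sum using (inj₂)
open import Function.Base using (_∘_)
open import Relation.Binary.PropositionalEquality using (_≢_; refl; sym; trans; cong; cong₂; subst; module ≡-Reasoning)
open ≡-Reasoning

ℕ→ℚ-^ : ∀ m n → ℕ→ℚ (m ^ n) ≡ ℤ→ℚ ((+ m) ℤ.^ n)
ℕ→ℚ-^ m n = cong ℤ→ℚ (pos-^ m n)

applyUpTo-cong : ∀ {A : Set} {f g : ℕ → A} → (∀ i → f i ≡ g i) → ∀ n → applyUpTo f n ≡ applyUpTo g n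
applyUpTo-cong f≗g zero    = refl
applyUpTo-cong f≗g (suc n) = cong₂ List._∷_ (f≗g 0) (applyUpTo-cong (f≗g ∘ suc) n)

module _ (Q : ℕ) (1<Q : 1 < Q) where

  private
    factor : ℕ → ℕ → ℕ → ℚ
    factor a b i = (ℕ→ℚ (Q ^ a) - ℕ→ℚ (Q ^ i)) ÷' (ℕ→ℚ (Q ^ b) - ℕ→ℚ (Q ^ i))

    powers-difference : ∀ a i → ℕ→ℚ (Q ^ a) - ℕ→ℚ (Q ^ i) ≡ ℤ→ℚ ((+ Q) ℤ.^ a ℤ.- (+ Q) ℤ.^ i)
    powers-difference a i = begin
      ℕ→ℚ (Q ^ a) - ℕ→ℚ (Q ^ i)               ≡⟨ cong₂ _-_ (ℕ→ℚ-^ Q a) (ℕ→ℚ-^ Q i) ⟩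
      ℤ→ℚ ((+ Q) ℤ.^ a) - ℤ→ℚ ((+ Q) ℤ.^ i)       ≡⟨ cong (_+_ (ℤ→ℚ ((+ Q) ℤ.^ a))) (ℤ→ℚ-homo‿- ((+ Q) ℤ.^ i)) ⟨
      ℤ→ℚ ((+ Q) ℤ.^ a) + ℤ→ℚ (ℤ.- (+ Q) ℤ.^ i)  ≡⟨ ℤ→ℚ-homo-+ ((+ Q) ℤ.^ a) (ℤ.- (+ Q) ℤ.^ i) ⟨
      ℤ→ℚ ((+ Q) ℤ.^ a ℤ.- (+ Q) ℤ.^ i)           ∎

    factor-shift : ∀ a b i → factor (suc a) (suc b) (suc i) ≡ factor a b i
    factor-shift a b i = begin
      factor (suc a) (suc b) (suc i)
        ≡⟨ cong₂ _÷'_ (trans (powers-difference (suc a) (suc i)) (scaled a)) (trans (powers-difference (suc b) (suc i)) (scaled b)) ⟩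
      (ℤ→ℚ (+ Q) * ℤ→ℚ (Qᵃ a)) ÷' (ℤ→ℚ (+ Q) * ℤ→ℚ (Qᵃ b))
        ≡⟨ ÷'-scale Q≢0 (ℤ→ℚ (Qᵃ a)) (ℤ→ℚ (Qᵃ b)) ⟩
      ℤ→ℚ (Qᵃ a) ÷' ℤ→ℚ (Qᵃ b)
        ≡⟨ cong₂ _÷'_ (powers-difference a i) (powers-difference b i) ⟨
      factor a b i ∎
      where
      Qᵃ : ℕ → ℤ
      Qᵃ a = (+ Q) ℤ.^ a ℤ.- (+ Q) ℤ.^ i
      factor-out : ∀ Q A I → Q ℤ.* A ℤ.- Q ℤ.* I ≡ Q ℤ.* (A ℤ.- I)
      factor-out = solve-∀
      scaled : ∀ a → ℤ→ℚ ((+ Q) ℤ.^ suc a ℤ.- (+ Q) ℤ.^ suc i) ≡ ℤ→ℚ (+ Q) * ℤ→ℚ (Qᵃ a)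
      scaled a = trans (cong ℤ→ℚ (factor-out (+ Q) ((+ Q) ℤ.^ a) ((+ Q) ℤ.^ i))) (ℤ→ℚ-homo-* (+ Q) (Qᵃ a))
      Q≢0 : ℤ→ℚ (+ Q) ≢ 0ℚ
      Q≢0 = ℕ.<⇒≢ (ℕ.<-trans z<s 1<Q) ∘ sym ∘ ℤ.+-injective ∘ ℤ→ℚ-injective {j = 0ℤ}

    gaussBinom-suc : ∀ a b → gaussBinom Q (suc a) (suc b) ≡ factor (suc a) (suc b) 0 * gaussBinom Q a b
    gaussBinom-suc a b = begin
      prodℚ (map (factor (suc a) (suc b)) (upTo (suc b)))     ≡⟨ cong prodℚ (map-upTo (factor (suc a) (suc b)) (suc b)) ⟩
      factor (suc a) (suc b) 0 * prodℚ (applyUpTo (factor (suc a) (suc b) ∘ suc) b)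
        ≡⟨ cong (λ xs → factor (suc a) (suc b) 0 * prodℚ xs) (applyUpTo-cong (factor-shift a b) b) ⟩
      factor (suc a) (suc b) 0 * prodℚ (applyUpTo (factor a b) b)
        ≡⟨ cong (λ xs → factor (suc a) (suc b) 0 * prodℚ xs) (map-upTo (factor a b) b) ⟨
      factor (suc a) (suc b) 0 * gaussBinom Q a b ∎

  gaussBinom≡gauss : ∀ m n → gaussBinom Q (m ℕ.+ n) m ≡ ℤ→ℚ (gauss (+ Q) m n)
  gaussBinom≡gauss zero    n = refl
  gaussBinom≡gauss (suc m) n = begin
    gaussBinom Q (suc m ℕ.+ n) (suc m)                   ≡⟨ gaussBinom-suc (m ℕ.+ n) m ⟩
    factor (suc m ℕ.+ n) (suc m) 0 * gaussBinom Q (m ℕ.+ n) m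
      ≡⟨ cong₂ _*_ (cong₂ _÷'_ (powers-difference (suc m ℕ.+ n) 0) (powers-difference (suc m) 0)) (gaussBinom≡gauss m n) ⟩
    (ℤ→ℚ (N ℤ.- 1ℤ) ÷' ℤ→ℚ (D ℤ.- 1ℤ)) * ℤ→ℚ (gauss (+ Q) m n)
      ≡⟨ ℤ→ℚ-÷'-exact (N ℤ.- 1ℤ) (D ℤ.- 1ℤ) (gauss (+ Q) m n) (gauss (+ Q) (suc m) n) D-1≢0 absorption ⟩
    ℤ→ℚ (gauss (+ Q) (suc m) n) ∎
    where
    N D : ℤ
    N = (+ Q) ℤ.^ (suc m ℕ.+ n)
    D = (+ Q) ℤ.^ suc m
    D-1≢0 : D ℤ.- 1ℤ ≢ 0ℤ
    D-1≢0 = subst (λ P → P ℤ.- 1ℤ ≢ 0ℤ) (pos-^ Q (suc m)) (pos+unit≢0 (^-monoʳ-< Q 1<Q (z<s {m})) unit⁻)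
    absorption : (N ℤ.- 1ℤ) ℤ.* gauss (+ Q) m n ≡ gauss (+ Q) (suc m) n ℤ.* (D ℤ.- 1ℤ)
    absorption = trans (cong (λ P → (P ℤ.- 1ℤ) ℤ.* gauss (+ Q) m n) (^-distribˡ-+-* (+ Q) (suc m) n))
                   (trans (gauss-absorption (+ Q) m n) (ℤ.*-comm (D ℤ.- 1ℤ) (gauss (+ Q) (suc m) n)))

IsOdd⇒2∣n-1 : ∀ {n} → IsOdd n → + 2 ∣ + n ℤ.- 1ℤ
IsOdd⇒2∣n-1 {n} n-odd = divides (+ (n ℕ./ 2)) (begin
  + n ℤ.- 1ℤ                       ≡⟨ cong (λ k → + k ℤ.- 1ℤ) (trans (m≡m%n+[m/n]*n n 2) (cong (ℕ._+ (n ℕ./ 2) ℕ.* 2) n-odd)) ⟩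
  + (suc (n ℕ./ 2 ℕ.* 2)) ℤ.- 1ℤ   ≡⟨⟩
  + (n ℕ./ 2 ℕ.* 2)                ≡⟨ pos-* (n ℕ./ 2) 2 ⟩
  + (n ℕ./ 2) ℤ.* + 2              ∎)

IsPrimePower⇒1< : ∀ {q} → IsPrimePower q → 1 < q
IsPrimePower⇒1< (p , k , p-prime , refl) = ^-monoʳ-< p (nonTrivial⇒n>1 p {{prime⇒nonTrivial p-prime}}) (z<s {k})

-- For ε, δ ∈ {1ℤ, -1ℤ} the terms ℤ→ℚ ε, ℤ→ℚ δ and ℤ→ℚ (ε ℤ.* δ) reduce to 1ℚ or - 1ℚ,
-- so the four quotients of corollary3p9 are definitionally instances of this lemma.
quotient-isInteger : ∀ {q} → 1 < q → IsOdd q → ∀ {ε δ} → IsUnit ε → IsUnit δ → ∀ {λ' μ} → 1 ≤ μ → μ ≤ λ' →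
  IsInteger ((((ℕ→ℚ (q ^ μ) + ℤ→ℚ ε) * (ℕ→ℚ (q ^ (λ' ∸ μ)) + ℤ→ℚ δ))
               ÷' (ℕ→ℚ 2 * (ℕ→ℚ (q ^ λ') + ℤ→ℚ (ε ℤ.* δ)))) * gaussBinom (q ^ 2) λ' μ)
quotient-isInteger {q} 1<q q-odd {ε} {δ} ε-unit δ-unit {λ'} {suc m} _ μ≤λ'
  with λ' ∸ suc m | m+[n∸m]≡n μ≤λ'
... | n | refl = Z , (begin
  (((ℕ→ℚ (q ^ suc m) + ℤ→ℚ ε) * (ℕ→ℚ (q ^ n) + ℤ→ℚ δ))
     ÷' (ℕ→ℚ 2 * (ℕ→ℚ (q ^ (suc m ℕ.+ n)) + ℤ→ℚ (ε ℤ.* δ)))) * gaussBinom (q ^ 2) (suc m ℕ.+ n) (suc m)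
    ≡⟨ cong₂ _*_ (cong₂ _÷'_ numerator denominator) binomial ⟩
  (ℤ→ℚ X ÷' ℤ→ℚ Y) * ℤ→ℚ G     ≡⟨ ℤ→ℚ-÷'-exact X Y G Z Y≢0 (_∣_.equality Y∣XG) ⟩
  ℤ→ℚ Z                         ∎)
  where
  x a b X Y G : ℤ
  x = + q
  a = x ℤ.^ suc m
  b = x ℤ.^ n
  X = (a ℤ.+ ε) ℤ.* (b ℤ.+ δ)
  Y = + 2 ℤ.* (a ℤ.* b ℤ.+ ε ℤ.* δ)
  G = gauss (x ℤ.* x) (suc m) n
  Y∣XG : Y ∣ X ℤ.* G
  Y∣XG = quotient-divisible x (IsOdd⇒2∣n-1 {q} q-odd) ε-unit δ-unit m n
  Z : ℤ
  Z = _∣_.quotient Y∣XG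
  x^λ : a ℤ.* b ≡ + (q ^ (suc m ℕ.+ n))
  x^λ = sym (trans (pos-^ q (suc m ℕ.+ n)) (^-distribˡ-+-* x (suc m) n))
  Y≢0 : Y ≢ 0ℤ
  Y≢0 Y≡0 with i*j≡0⇒i≡0∨j≡0 (+ 2) Y≡0
  ... | inj₂ ab+εδ≡0 = pos+unit≢0 (^-monoʳ-< q 1<q (z<s {m ℕ.+ n})) (IsUnit-* ε-unit δ-unit)
                         (trans (cong (ℤ._+ ε ℤ.* δ) (sym x^λ)) ab+εδ≡0)
  shifted-power : ∀ k u → ℕ→ℚ (q ^ k) + ℤ→ℚ u ≡ ℤ→ℚ (x ℤ.^ k ℤ.+ u)
  shifted-power k u = trans (cong (_+ ℤ→ℚ u) (ℕ→ℚ-^ q k)) (sym (ℤ→ℚ-homo-+ (x ℤ.^ k) u))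
  numerator : (ℕ→ℚ (q ^ suc m) + ℤ→ℚ ε) * (ℕ→ℚ (q ^ n) + ℤ→ℚ δ) ≡ ℤ→ℚ X
  numerator = trans (cong₂ _*_ (shifted-power (suc m) ε) (shifted-power n δ)) (sym (ℤ→ℚ-homo-* (a ℤ.+ ε) (b ℤ.+ δ)))
  denominator : ℕ→ℚ 2 * (ℕ→ℚ (q ^ (suc m ℕ.+ n)) + ℤ→ℚ (ε ℤ.* δ)) ≡ ℤ→ℚ Y
  denominator = trans (cong (ℕ→ℚ 2 *_) (trans (shifted-power (suc m ℕ.+ n) (ε ℤ.* δ))
                  (cong (λ P → ℤ→ℚ (P ℤ.+ ε ℤ.* δ)) (^-distribˡ-+-* x (suc m) n))))
                  (sym (ℤ→ℚ-homo-* (+ 2) (a ℤ.* b ℤ.+ ε ℤ.* δ)))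
  binomial : gaussBinom (q ^ 2) (suc m ℕ.+ n) (suc m) ≡ ℤ→ℚ G
  binomial = trans (gaussBinom≡gauss (q ^ 2) (^-monoʳ-< q 1<q (z<s {1})) (suc m) n)
                   (cong (λ Q → ℤ→ℚ (gauss Q (suc m) n)) (trans (pos-^ q 2) (cong (x ℤ.*_) (ℤ.*-identityʳ x))))

corollary3p9 : (q λ' μ : ℕ) → IsPrimePower q → IsOdd q → 1 ≤ μ → μ ≤ λ' →
  ((q % 4 ≡ 3 → IsOdd λ' →
      IsInteger ((((ℕ→ℚ (q ^ μ) + 1ℚ) * (ℕ→ℚ (q ^ (λ' ∸ μ)) + 1ℚ)) ÷' (ℕ→ℚ 2 * (ℕ→ℚ (q ^ λ') + 1ℚ))) * gaussBinom (q ^ 2) λ' μ)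
      × IsInteger ((((ℕ→ℚ (q ^ μ) - 1ℚ) * (ℕ→ℚ (q ^ (λ' ∸ μ)) - 1ℚ)) ÷' (ℕ→ℚ 2 * (ℕ→ℚ (q ^ λ') + 1ℚ))) * gaussBinom (q ^ 2) λ' μ))
   × (((q % 4 ≡ 3 × λ' % 2 ≡ 0) ⊎ q % 4 ≡ 1) →
      IsInteger ((((ℕ→ℚ (q ^ μ) + 1ℚ) * (ℕ→ℚ (q ^ (λ' ∸ μ)) - 1ℚ)) ÷' (ℕ→ℚ 2 * (ℕ→ℚ (q ^ λ') - 1ℚ))) * gaussBinom (q ^ 2) λ' μ)
      × IsInteger ((((ℕ→ℚ (q ^ μ) - 1ℚ) * (ℕ→ℚ (q ^ (λ' ∸ μ)) + 1ℚ)) ÷' (ℕ→ℚ 2 * (ℕ→ℚ (q ^ λ') - 1ℚ))) * gaussBinom (q ^ 2) λ' μ)))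
corollary3p9 q λ' μ q-primePower q-odd 1≤μ μ≤λ' =
  ( (λ _ _ → quotient-isInteger 1<q q-odd unit⁺ unit⁺ 1≤μ μ≤λ' , quotient-isInteger 1<q q-odd unit⁻ unit⁻ 1≤μ μ≤λ')
  , (λ _ → quotient-isInteger 1<q q-odd unit⁺ unit⁻ 1≤μ μ≤λ' , quotient-isInteger 1<q q-odd unit⁻ unit⁺ 1≤μ μ≤λ'))
  where
  1<q : 1 < q
  1<q = IsPrimePower⇒1< q-primePower
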